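{- Let $d>1$ and $m$ be positive integers, and for each positive integer $n$ let $a_n = 2^{2^n}+d$. Assume that $\gcd(a_k,a_l) \le m$ for all distinct positive integers $k \neq l$. Then $d$ is a power of $2$. -}

module Defs where

open import Data.Nat using (ℕ; _+_; _^_)

a : ℕ → ℕ → ℕ
a d n = 2 ^ (2 ^ n) + d

module Submission where

-- Write d = 2^s·t with t odd; we show t = 1. Choose k large and write 2^k = s + e with e > k,
-- so that a_k = 2^s·O with O = 2^e + t odd and O ≡ t (mod 2^(k+1)). As O is odd, some
-- 2^(N·2^c) ≡ 1 (mod O) with N odd and N + 1 a power of two, say 2^(j+1). The factorisation
-- 2^(2x) - 1 = (2^x - 1)(2^x + 1), together with the fact (from Fermat's little theorem) that
-- every divisor of 2^(N·2^n) + 1 is ≡ 1 (mod 2^(n+1)), splits O = G·H with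
-- 2^(N·2^k) ≡ 1 (mod G) and H ≡ 1 (mod 2^(k+1)). Then G divides a_k and a_(k+j+1), so
-- G ≤ m < 2^(k+1); since G ≡ G·H = O ≡ t (mod 2^(k+1)), G = t. So t divides O - t = 2^e, t = 1.

open import Defs
open import Data.Nat using (ℕ; _^_; _≤_; _<_)
open import Data.Nat.GCD using (gcd)
open import Data.Product using (∃-syntax)
open import Relation.Binary.PropositionalEquality using (_≡_; _≢_)

open import Data.Nat.Base
  using (zero; suc; _+_; _*_; _∸_; _!; _%_; _/_; NonZero; ≢-nonZero; nonTrivial⇒n>1; z≤n; s≤s; z<s)
open import Data.Nat.Properties
open import Data.Nat.Divisibility
  using (_∣_; divides; ∣-refl; ∣-trans; 1∣_; ∣1⇒≡1; 0∣⇒≡0; ∣⇒≤; m∣m*n; n∣m*n;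
         ∣m∣n⇒∣m+n; ∣m+n∣m⇒∣n; *-monoʳ-∣; *-cancelˡ-∣)
open import Data.Nat.DivMod using (m≡m%n+[m/n]*n; m%n<n; m<n⇒m%n≡m; [m+kn]%n≡m%n; m*[n/m]≡n)
open import Data.Nat.GCD using (gcd[m,n]∣m; gcd[m,n]∣n; gcd[m,n]≢0; gcd-greatest)
open import Data.Nat.Coprimality using (Coprime; coprime-divisor; coprime-/gcd; coprime-+; 1-coprimeTo)
open import Data.Nat.Primality using (Prime; euclidsLemma; prime⇒nonTrivial)
open import Data.Nat.Primality.Factorisation using (factorise)
open import Data.Nat.Combinatorics
  using (_C_; nCn≡1; nCk+nC[k+1]≡[n+1]C[k+1]; k>n⇒nCk≡0; nCk≡n!/k![n-k]!; k![n∸k]!∣n!)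
open import Data.Nat.ListAction using (product)
open import Data.Nat.Induction using (<-wellFounded)
open import Induction.WellFounded using (Acc; acc)
open import Data.List.Base using ([]; _∷_)
open import Data.List.Relation.Unary.All using (All; []; _∷_)
open import Data.Fin.Base using (Fin; toℕ; fromℕ<)
open import Data.Fin.Properties using (pigeonhole; toℕ-fromℕ<)
open import Data.Product using (_,_; _×_)
open import Data.Sum using (_⊎_; inj₁; inj₂)
open import Data.Empty using (⊥-elim)
open import Relation.Nullary using (¬_; Dec; yes; no)
open import Relation.Binary.PropositionalEquality
  using (refl; sym; trans; cong; cong₂; subst; subst₂; module ≡-Reasoning)
open import Data.Nat.Tactic.RingSolver using (solve-∀)

infix 4 _≡1[mod_]
record _≡1[mod_] (x D : ℕ) : Set where
  constructor ≡1-by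
  field
    q  : ℕ
    eq : x ≡ 1 + D * q

≡1-refl : ∀ {D} → 1 ≡1[mod D ]
≡1-refl {D} = ≡1-by 0 (cong suc (sym (*-zeroʳ D)))

≡1-* : ∀ {D x y} → x ≡1[mod D ] → y ≡1[mod D ] → x * y ≡1[mod D ]
≡1-* {D} (≡1-by q refl) (≡1-by r refl) = ≡1-by (q + r + D * q * r) (expand D q r)
  where
  expand : ∀ D q r → (1 + D * q) * (1 + D * r) ≡ 1 + D * (q + r + D * q * r)
  expand = solve-∀

≡1-^ : ∀ {D x} → x ≡1[mod D ] → ∀ n → x ^ n ≡1[mod D ]
≡1-^ x≡1 zero = ≡1-refl
≡1-^ x≡1 (suc n) = ≡1-* x≡1 (≡1-^ x≡1 n)

≡1-∣ : ∀ {D D′ x} → D′ ∣ D → x ≡1[mod D ] → x ≡1[mod D′ ]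
≡1-∣ {D′ = D′} (divides k refl) (≡1-by q refl) = ≡1-by (k * q) (cong suc (reassoc k D′ q))
  where
  reassoc : ∀ k D′ q → k * D′ * q ≡ D′ * (k * q)
  reassoc = solve-∀

∣⇒≡1 : ∀ {D b} → D ∣ b → suc b ≡1[mod D ]
∣⇒≡1 {D} (divides q refl) = ≡1-by q (cong suc (*-comm q D))

≡1⇒∣ : ∀ {D b} → suc b ≡1[mod D ] → D ∣ b
≡1⇒∣ {D} (≡1-by q eq) = divides q (trans (suc-injective eq) (*-comm D q))

2^n≡suc : ∀ n → ∃[ b ] 2 ^ n ≡ suc b
2^n≡suc n with 2 ^ n | m^n>0 2 n
... | suc b | _ = b , refl

even-or-odd : ∀ n → ∃[ h ] (n ≡ 2 * h ⊎ n ≡ 1 + 2 * h)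
even-or-odd zero = 0 , inj₁ refl
even-or-odd (suc n) with even-or-odd n
... | h , inj₁ refl = h , inj₂ refl
... | h , inj₂ refl = suc h , inj₁ (sym (+-suc (suc h) (h + 0)))

2-adic : ∀ n → 0 < n → ∃[ s ] ∃[ u ] n ≡ 2 ^ s * (1 + 2 * u)
2-adic n = go n (<-wellFounded n)
  where
  go : ∀ n → Acc _<_ n → 0 < n → ∃[ s ] ∃[ u ] n ≡ 2 ^ s * (1 + 2 * u)
  go n _ n>0 with even-or-odd n
  go n _ n>0 | u , inj₂ n≡odd = 0 , u , trans n≡odd (sym (+-identityʳ _))
  go n (acc rec) n>0 | suc h , inj₁ refl with go (suc h) (rec (m<m+n (suc h) z<s)) z<s
  ... | s , u , eq = suc s , u , trans (cong (2 *_) eq) (sym (*-assoc 2 (2 ^ s) _))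

odd-coprime-2 : ∀ u → Coprime (1 + 2 * u) 2
odd-coprime-2 zero = 1-coprimeTo 2
odd-coprime-2 (suc u) = subst (λ n → Coprime n 2) (step u) (coprime-+ (odd-coprime-2 u))
  where
  step : ∀ u → 2 + (1 + 2 * u) ≡ 1 + 2 * suc u
  step = solve-∀

coprime-2-cancel : ∀ {n y} → Coprime n 2 → ∀ i → n ∣ 2 ^ i * y → n ∣ y
coprime-2-cancel {n} {y} _ zero n∣ = subst (n ∣_) (+-identityʳ y) n∣
coprime-2-cancel {n} {y} cop (suc i) n∣ =
  coprime-2-cancel cop i (coprime-divisor cop (subst (n ∣_) (*-assoc 2 (2 ^ i) y) n∣))

odd∣2^i⇒≡1 : ∀ u i → 1 + 2 * u ∣ 2 ^ i → 1 + 2 * u ≡ 1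
odd∣2^i⇒≡1 u i t∣ =
  ∣1⇒≡1 (coprime-2-cancel (odd-coprime-2 u) i
           (subst (1 + 2 * u ∣_) (sym (*-identityʳ (2 ^ i))) t∣))

%-≡⇒∣ : ∀ x z n .{{_ : NonZero n}} → x % n ≡ (x + z) % n → n ∣ z
%-≡⇒∣ x z n same =
  ∣m+n∣m⇒∣n (divides ((x + z) / n) (+-cancelˡ-≡ (x % n) _ _ both-sides)) (divides (x / n) refl)
  where
  open ≡-Reasoning
  both-sides : x % n + (x / n * n + z) ≡ x % n + (x + z) / n * n
  both-sides = begin
    x % n + (x / n * n + z)        ≡⟨ +-assoc (x % n) _ z ⟨
    x % n + x / n * n + z          ≡⟨ cong (_+ z) (m≡m%n+[m/n]*n x n) ⟨
    x + z                          ≡⟨ m≡m%n+[m/n]*n (x + z) n ⟩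
    (x + z) % n + (x + z) / n * n  ≡⟨ cong (_+ (x + z) / n * n) same ⟨
    x % n + (x + z) / n * n        ∎

2^-collision : ∀ u i δ → 2 ^ i % (1 + 2 * u) ≡ 2 ^ (i + suc δ) % (1 + 2 * u) →
               2 ^ suc δ ≡1[mod 1 + 2 * u ]
2^-collision u i δ same with 2^n≡suc (suc δ)
... | X , 2^δ≡ = subst (_≡1[mod 1 + 2 * u ]) (sym 2^δ≡) (∣⇒≡1 O∣X)
  where
  split-power : 2 ^ (i + suc δ) ≡ 2 ^ i + 2 ^ i * X
  split-power = trans (^-distribˡ-+-* 2 i (suc δ)) (trans (cong (2 ^ i *_) 2^δ≡) (*-suc (2 ^ i) X))
  O∣X : 1 + 2 * u ∣ X
  O∣X = coprime-2-cancel (odd-coprime-2 u) i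
          (%-≡⇒∣ (2 ^ i) (2 ^ i * X) (1 + 2 * u) (trans same (cong (_% (1 + 2 * u)) split-power)))

2^-residue : ∀ O .{{_ : NonZero O}} → Fin (suc O) → Fin O
2^-residue O i = fromℕ< (m%n<n (2 ^ toℕ i) O)

2^-residue-≡ : ∀ O .{{_ : NonZero O}} i j →
               2^-residue O i ≡ 2^-residue O j → 2 ^ toℕ i % O ≡ 2 ^ toℕ j % O
2^-residue-≡ O i j same =
  trans (sym (toℕ-fromℕ< (m%n<n (2 ^ toℕ i) O)))
        (trans (cong toℕ same) (toℕ-fromℕ< (m%n<n (2 ^ toℕ j) O)))

-- Some positive power of two is ≡ 1 modulo any odd number O: two of the residues of
-- 2^0, …, 2^O modulo O coincide (pigeonhole). Only the existence of the exponent is used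
-- later, so the proof is opaque; this keeps Agda from unfolding the pigeonhole search.
opaque
  2^[1+δ]≡1 : ∀ u → ∃[ δ ] 2 ^ suc δ ≡1[mod 1 + 2 * u ]
  2^[1+δ]≡1 u
    with i , j , i<j , same ← pigeonhole (n<1+n (1 + 2 * u)) (2^-residue (1 + 2 * u))
    with δ , i+δ≡j ← m≤n⇒∃[o]m+o≡n i<j =
    δ , 2^-collision u (toℕ i) δ
          (trans (2^-residue-≡ (1 + 2 * u) i j same)
                 (cong (λ e → 2 ^ e % (1 + 2 * u)) (sym (trans (+-suc (toℕ i) δ) i+δ≡j))))

rowSum : ℕ → ℕ → ℕ
rowSum n zero = 0
rowSum n (suc j) = rowSum n j + n C j

rowSum-pascal : ∀ n j → rowSum (suc n) (suc j) ≡ rowSum n j + rowSum n (suc j)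
rowSum-pascal n zero = refl
rowSum-pascal n (suc j) = begin
  rowSum (suc n) (suc j) + suc n C suc j
    ≡⟨ cong₂ _+_ (rowSum-pascal n j) (sym (nCk+nC[k+1]≡[n+1]C[k+1] n j)) ⟩
  (rowSum n j + rowSum n (suc j)) + (n C j + n C suc j)
    ≡⟨ interchange (rowSum n j) (rowSum n (suc j)) (n C j) (n C suc j) ⟩
  rowSum n (suc j) + rowSum n (suc (suc j)) ∎
  where
  open ≡-Reasoning
  interchange : ∀ a b c e → (a + b) + (c + e) ≡ (a + c) + (b + e)
  interchange = solve-∀

rowSum-full : ∀ n → rowSum n (suc n) ≡ 2 ^ n
rowSum-full zero = refl
rowSum-full (suc n) = begin
  rowSum (suc n) (suc (suc n))                ≡⟨ rowSum-pascal n (suc n) ⟩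
  rowSum n (suc n) + (rowSum n (suc n) + n C suc n)
    ≡⟨ cong₂ (λ r c → r + (r + c)) (rowSum-full n) (k>n⇒nCk≡0 (n<1+n n)) ⟩
  2 ^ n + (2 ^ n + 0)                         ∎
  where open ≡-Reasoning

prime>1 : ∀ {p} → Prime p → 1 < p
prime>1 {p} pr = nonTrivial⇒n>1 p {{prime⇒nonTrivial pr}}

prime∤! : ∀ {p} → Prime p → ∀ k → k < p → ¬ p ∣ k !
prime∤! pr zero _ p∣1 = <⇒≢ (prime>1 pr) (sym (∣1⇒≡1 p∣1))
prime∤! pr (suc k) k<p p∣ with euclidsLemma (suc k) (k !) pr p∣
... | inj₁ p∣1+k = <⇒≱ k<p (∣⇒≤ p∣1+k)
... | inj₂ p∣k! = prime∤! pr k (<-trans (n<1+n k) k<p) p∣k!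

binomial-factorials : ∀ {n k} → k ≤ n → k ! * (n ∸ k) ! * (n C k) ≡ n !
binomial-factorials {n} {k} k≤n = begin
  k ! * (n ∸ k) ! * (n C k)                   ≡⟨ cong (k ! * (n ∸ k) ! *_) (nCk≡n!/k![n-k]! k≤n) ⟩
  k ! * (n ∸ k) ! * (n ! / (k ! * (n ∸ k) !)) ≡⟨ m*[n/m]≡n (k![n∸k]!∣n! k≤n) ⟩
  n !                                         ∎
  where
  open ≡-Reasoning
  instance _ = k !* (n ∸ k) !≢0

-- A prime p divides the inner binomial coefficients p C k, 0 < k < p,
-- since it divides p! = k! (p-k)! (p C k) but neither k! nor (p-k)!.
prime∣C : ∀ {p} → Prime p → ∀ k → 0 < k → k < p → p ∣ p C k
prime∣C {suc p′} pr (suc k′) _ k<p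
  with euclidsLemma (suc k′ ! * (p′ ∸ k′) !) (suc p′ C suc k′) pr
         (subst (suc p′ ∣_) (sym (binomial-factorials (<⇒≤ k<p))) (m∣m*n (p′ !)))
... | inj₂ p∣C = p∣C
... | inj₁ p∣k![p-k]! with euclidsLemma (suc k′ !) ((p′ ∸ k′) !) pr p∣k![p-k]!
...   | inj₁ p∣k! = ⊥-elim (prime∤! pr (suc k′) k<p p∣k!)
...   | inj₂ p∣[p-k]! = ⊥-elim (prime∤! pr (p′ ∸ k′) (s≤s (m∸n≤m p′ k′)) p∣[p-k]!)

rowSum-prime : ∀ {p} → Prime p → ∀ j → j < p → rowSum p (suc j) ≡1[mod p ]
rowSum-prime pr zero _ = ≡1-refl
rowSum-prime {p} pr (suc j) j<p
  with rowSum-prime pr j (<-trans (n<1+n j) j<p) | prime∣C pr (suc j) z<s j<p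
... | ≡1-by q sum≡ | divides c C≡ = ≡1-by (q + c) (begin
  rowSum p (suc j) + p C suc j  ≡⟨ cong₂ _+_ sum≡ C≡ ⟩
  1 + p * q + c * p            ≡⟨ regroup p q c ⟩
  1 + p * (q + c)              ∎)
  where
  open ≡-Reasoning
  regroup : ∀ p q c → 1 + p * q + c * p ≡ 1 + p * (q + c)
  regroup = solve-∀

-- Fermat's little theorem for the base 2: 2^(p-1) ≡ 1 (mod p) for every odd prime p.
-- The row sum gives 2^p = (1 + p q) + 1, so p divides 2 (2^(p-1) - 1).
fermat-2 : ∀ {p} → Prime p → p ≢ 2 → 2 ^ (p ∸ 1) ≡1[mod p ]
fermat-2 {suc p′} pr p≢2 with rowSum-prime pr p′ (n<1+n p′) | 2^n≡suc p′
... | ≡1-by q row≡ | X , 2^p′≡ = subst (_≡1[mod suc p′ ]) (sym 2^p′≡) (∣⇒≡1 p∣X)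
  where
  open ≡-Reasoning
  2X≡pq : 2 * X ≡ suc p′ * q
  2X≡pq = +-cancelˡ-≡ 2 _ _ (begin
    2 + 2 * X                                    ≡⟨ *-suc 2 X ⟨
    2 * suc X                                    ≡⟨ cong (2 *_) 2^p′≡ ⟨
    2 ^ suc p′                                   ≡⟨ rowSum-full (suc p′) ⟨
    rowSum (suc p′) (suc p′) + suc p′ C suc p′  ≡⟨ cong₂ _+_ row≡ (nCn≡1 (suc p′)) ⟩
    1 + suc p′ * q + 1                           ≡⟨ +-comm (1 + suc p′ * q) 1 ⟩
    2 + suc p′ * q                               ∎)
  p∣X : suc p′ ∣ X
  p∣X with euclidsLemma 2 X pr (divides q (trans 2X≡pq (*-comm (suc p′) q)))
  ... | inj₁ p∣2 = ⊥-elim (p≢2 (≤-antisym (∣⇒≤ p∣2) (prime>1 pr)))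
  ... | inj₂ p∣X = p∣X

square≡1 : ∀ b → suc b ^ 2 ≡1[mod suc b + 1 ]
square≡1 b = ≡1-by b (expand b)
  where
  expand : ∀ b → (1 + b) * ((1 + b) * 1) ≡ 1 + (1 + b + 1) * b
  expand = solve-∀

odd-power+1 : ∀ x w → x + 1 ∣ x ^ (1 + 2 * w) + 1
odd-power+1 zero w = 1∣ _
odd-power+1 (suc b) w with ≡1-^ (square≡1 b) w
... | ≡1-by c x²ʷ≡ = divides (1 + suc b * c) (begin
  suc b ^ (1 + 2 * w) + 1           ≡⟨ cong (λ z → suc b * z + 1) (^-*-assoc (suc b) 2 w) ⟨
  suc b * (suc b ^ 2) ^ w + 1       ≡⟨ cong (λ z → suc b * z + 1) x²ʷ≡ ⟩
  suc b * (1 + (suc b + 1) * c) + 1 ≡⟨ factor b c ⟩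
  (1 + suc b * c) * (suc b + 1)     ∎)
  where
  open ≡-Reasoning
  factor : ∀ b c → (1 + b) * (1 + (1 + b + 1) * c) + 1 ≡ (1 + (1 + b) * c) * (1 + b + 1)
  factor = solve-∀

≡1∧∣+1⇒∣2 : ∀ {D x} → x ≡1[mod D ] → D ∣ x + 1 → D ∣ 2
≡1∧∣+1⇒∣2 {D} (≡1-by q refl) D∣ =
  ∣m+n∣m⇒∣n (subst (D ∣_) (trans (+-comm (1 + D * q) 1) (+-comm 2 (D * q))) D∣) (m∣m*n q)

2∤2^e+1 : ∀ e → 0 < e → ¬ 2 ∣ 2 ^ e + 1
2∤2^e+1 (suc e) _ 2∣ with ∣1⇒≡1 (∣m+n∣m⇒∣n 2∣ (m∣m*n (2 ^ e)))
... | ()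

exponent-regroup : ∀ c r w N → (2 ^ (2 ^ c * w)) ^ (2 ^ r * N) ≡ (2 ^ (N * 2 ^ (c + r))) ^ w
exponent-regroup c r w N = begin
  (2 ^ (2 ^ c * w)) ^ (2 ^ r * N) ≡⟨ ^-*-assoc 2 (2 ^ c * w) (2 ^ r * N) ⟩
  2 ^ (2 ^ c * w * (2 ^ r * N))   ≡⟨ cong (2 ^_) (shuffle (2 ^ c) (2 ^ r) w N) ⟩
  2 ^ (N * (2 ^ c * 2 ^ r) * w)   ≡⟨ cong (λ e → 2 ^ (N * e * w)) (^-distribˡ-+-* 2 c r) ⟨
  2 ^ (N * 2 ^ (c + r) * w)       ≡⟨ ^-*-assoc 2 (N * 2 ^ (c + r)) w ⟨
  (2 ^ (N * 2 ^ (c + r))) ^ w     ∎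
  where
  open ≡-Reasoning
  shuffle : ∀ x y w N → x * w * (y * N) ≡ N * (x * y) * w
  shuffle = solve-∀

-- Write p - 1 = 2^c w with w odd. If c ≤ n, say n = c + r, then A = 2^(N·2^n) satisfies
-- A^w = (2^(p-1))^(2^r N) ≡ 1 (mod p) by Fermat, while p ∣ A + 1 ∣ A^w + 1; so p ∣ 2, impossible.
prime-divisor-shape : ∀ {p} → Prime p → ∀ v n →
                      p ∣ 2 ^ ((1 + 2 * v) * 2 ^ n) + 1 → p ≡1[mod 2 ^ suc n ]
prime-divisor-shape {suc p′} pr v n p∣A+1 with 2-adic p′ (≤-pred (prime>1 pr))
... | c , w , p′≡ = by-cases (suc n ≤? c)
  where
  N = 1 + 2 * v
  A = 2 ^ (N * 2 ^ n)
  p≢2 : suc p′ ≢ 2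
  p≢2 p≡2 = 2∤2^e+1 (N * 2 ^ n) (<-≤-trans (m^n>0 2 n) (m≤n*m (2 ^ n) N))
                    (subst (_∣ A + 1) p≡2 p∣A+1)
  by-cases : Dec (suc n ≤ c) → suc p′ ≡1[mod 2 ^ suc n ]
  by-cases (yes n<c) with r , n+r≡c ← m≤n⇒∃[o]m+o≡n n<c =
    ≡1-by (2 ^ r * (1 + 2 * w)) (cong suc (begin
      p′                                ≡⟨ p′≡ ⟩
      2 ^ c * (1 + 2 * w)               ≡⟨ cong (λ e → 2 ^ e * (1 + 2 * w)) n+r≡c ⟨
      2 ^ (suc n + r) * (1 + 2 * w)     ≡⟨ cong (_* (1 + 2 * w)) (^-distribˡ-+-* 2 (suc n) r) ⟩
      2 ^ suc n * 2 ^ r * (1 + 2 * w)   ≡⟨ *-assoc (2 ^ suc n) (2 ^ r) (1 + 2 * w) ⟩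
      2 ^ suc n * (2 ^ r * (1 + 2 * w)) ∎))
    where open ≡-Reasoning
  by-cases (no n≮c) with r , c+r≡n ← m≤n⇒∃[o]m+o≡n (≮⇒≥ n≮c) =
    ⊥-elim (p≢2 (≤-antisym (∣⇒≤ p∣2) (prime>1 pr)))
    where
    A^w≡1 : A ^ (1 + 2 * w) ≡1[mod suc p′ ]
    A^w≡1 = subst (_≡1[mod suc p′ ])
      (trans (cong (λ e → (2 ^ e) ^ (2 ^ r * N)) p′≡)
        (trans (exponent-regroup c r (1 + 2 * w) N)
               (cong (λ e → (2 ^ (N * 2 ^ e)) ^ (1 + 2 * w)) c+r≡n)))
      (≡1-^ (fermat-2 pr p≢2) (2 ^ r * N))
    p∣2 : suc p′ ∣ 2
    p∣2 = ≡1∧∣+1⇒∣2 A^w≡1 (∣-trans p∣A+1 (odd-power+1 A w))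

-- Hence every divisor of 2^(N·2^n) + 1, N odd, is ≡ 1 (mod 2^(n+1)): it is a product of
-- prime divisors, each of which is.
divisor-shape : ∀ v n D → D ∣ 2 ^ ((1 + 2 * v) * 2 ^ n) + 1 → D ≡1[mod 2 ^ suc n ]
divisor-shape v n zero 0∣ = ⊥-elim (1+n≢0 (trans (+-comm 1 _) (0∣⇒≡0 0∣)))
divisor-shape v n (suc D) D∣ with factorise (suc D)
... | record { factors = ps ; isFactorisation = D≡∏ps ; factorsPrime = ps-prime } =
  subst (_≡1[mod 2 ^ suc n ]) (sym D≡∏ps) (primes ps ps-prime (subst (_∣ _) D≡∏ps D∣))
  where
  primes : ∀ ps → All Prime ps →
           product ps ∣ 2 ^ ((1 + 2 * v) * 2 ^ n) + 1 → product ps ≡1[mod 2 ^ suc n ]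
  primes [] _ _ = ≡1-refl
  primes (p ∷ ps) (p-prime ∷ ps-prime) ∏∣ =
    ≡1-* (prime-divisor-shape p-prime v n (∣-trans (m∣m*n (product ps)) ∏∣))
         (primes ps ps-prime (∣-trans (n∣m*n p) ∏∣))

-- A divisor of a product A·B splits as D₁·D₂ with D₁ ∣ A and D₂ ∣ B (take D₁ = gcd D A).
∣*-split : ∀ {D A B} → D ≢ 0 → D ∣ A * B → ∃[ D₁ ] ∃[ D₂ ] (D ≡ D₁ * D₂ × D₁ ∣ A × D₂ ∣ B)
∣*-split {D} {A} {B} D≢0 D∣AB = g , D / g , sym g*[D/g]≡D , gcd[m,n]∣n D A , D/g∣B
  where
  g = gcd D A
  instance _ = ≢-nonZero (gcd[m,n]≢0 D A (inj₁ D≢0))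
  g*[D/g]≡D : g * (D / g) ≡ D
  g*[D/g]≡D = m*[n/m]≡n (gcd[m,n]∣m D A)
  g*[A/g]*B≡AB : g * ((A / g) * B) ≡ A * B
  g*[A/g]*B≡AB = trans (sym (*-assoc g (A / g) B)) (cong (_* B) (m*[n/m]≡n (gcd[m,n]∣n D A)))
  D/g∣B : D / g ∣ B
  D/g∣B = coprime-divisor (coprime-/gcd D A)
            (*-cancelˡ-∣ g (subst₂ _∣_ (sym g*[D/g]≡D) (sym g*[A/g]*B≡AB) D∣AB))

^-∣-^+ : ∀ x m r → x ^ m ∣ x ^ (r + m)
^-∣-^+ x m r = divides (x ^ r) (^-distribˡ-+-* x r m)

2^[N*2y] : ∀ N y → 2 ^ (N * (2 * y)) ≡ 2 ^ (N * y) * 2 ^ (N * y)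
2^[N*2y] N y = trans (cong (2 ^_) (double N y)) (^-distribˡ-+-* 2 (N * y) (N * y))
  where
  double : ∀ N y → N * (2 * y) ≡ N * y + N * y
  double = solve-∀

-- Induction on r: with x = 2^(N·2^(r+k)),
-- D divides x² - 1 = (x - 1)(x + 1); the part dividing x - 1 is handled by induction and the
-- part dividing x + 1 is ≡ 1 (mod 2^(r+k+1)) by divisor-shape.
peel : ∀ v k r D → D ≢ 0 → 2 ^ ((1 + 2 * v) * 2 ^ (r + k)) ≡1[mod D ] →
       ∃[ G ] ∃[ H ] (D ≡ G * H × 2 ^ ((1 + 2 * v) * 2 ^ k) ≡1[mod G ] × H ≡1[mod 2 ^ suc k ])
peel v k zero D _ 2^≡1 = D , 1 , sym (*-identityʳ D) , 2^≡1 , ≡1-refl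
peel v k (suc r) D D≢0 2^≡1 with 2^n≡suc ((1 + 2 * v) * 2 ^ (r + k))
... | b , x≡1+b = assemble (∣*-split D≢0 (≡1⇒∣ (subst (_≡1[mod D ]) x²≡ 2^≡1)))
  where
  N = 1 + 2 * v
  x²≡ : 2 ^ (N * 2 ^ suc (r + k)) ≡ suc (b * (b + 2))
  x²≡ = trans (2^[N*2y] N (2 ^ (r + k))) (trans (cong₂ _*_ x≡1+b x≡1+b) (square b))
    where
    square : ∀ b → (1 + b) * (1 + b) ≡ 1 + b * (b + 2)
    square = solve-∀
  D₂≡1 : ∀ {D₂} → D₂ ∣ b + 2 → D₂ ≡1[mod 2 ^ suc k ]
  D₂≡1 {D₂} D₂∣ = ≡1-∣ (subst (2 ^ suc k ∣_) (cong (2 ^_) (+-suc r k)) (^-∣-^+ 2 (suc k) r))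
                        (divisor-shape v (r + k) D₂ (subst (D₂ ∣_) b+2≡x+1 D₂∣))
    where
    b+2≡x+1 : b + 2 ≡ 2 ^ (N * 2 ^ (r + k)) + 1
    b+2≡x+1 = trans (+-comm b 2) (trans (+-comm 1 (suc b)) (cong (_+ 1) (sym x≡1+b)))
  assemble : ∃[ D₁ ] ∃[ D₂ ] (D ≡ D₁ * D₂ × D₁ ∣ b × D₂ ∣ b + 2) →
             ∃[ G ] ∃[ H ] (D ≡ G * H × 2 ^ (N * 2 ^ k) ≡1[mod G ] × H ≡1[mod 2 ^ suc k ])
  assemble (D₁ , D₂ , D≡D₁D₂ , D₁∣b , D₂∣b+2)
    with peel v k r D₁ (λ D₁≡0 → D≢0 (trans D≡D₁D₂ (cong (_* D₂) D₁≡0)))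
                       (subst (_≡1[mod D₁ ]) (sym x≡1+b) (∣⇒≡1 D₁∣b))
  ... | G , H , D₁≡GH , G≡1 , H≡1 =
    G , H * D₂ , trans D≡D₁D₂ (trans (cong (_* D₂) D₁≡GH) (*-assoc G H D₂)) ,
    G≡1 , ≡1-* H≡1 (D₂≡1 D₂∣b+2)

^-multiple≡1 : ∀ {O x E F} → x ^ E ≡1[mod O ] → E ∣ F → x ^ F ≡1[mod O ]
^-multiple≡1 {O} {x} {E} x^E≡1 (divides k refl) =
  subst (_≡1[mod O ]) (trans (^-*-assoc x E k) (cong (x ^_) (*-comm E k))) (≡1-^ x^E≡1 k)

-- Every odd M divides some odd N with N + 1 a power of two: take 2^(j+1) ≡ 1 (mod M).
odd∣2^[1+j]-1 : ∀ w → ∃[ v ] ∃[ j ] (2 ^ suc j ≡ 2 + 2 * v × 1 + 2 * w ∣ 1 + 2 * v)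
odd∣2^[1+j]-1 w
  with j , ≡1-by q 2^[1+j]≡ ← 2^[1+δ]≡1 w
  with Z , 2^j≡ ← 2^n≡suc j =
  Z , j , 2^[1+j]≡2+2Z ,
  divides q (trans (suc-injective (trans (sym 2^[1+j]≡2+2Z) 2^[1+j]≡)) (*-comm (1 + 2 * w) q))
  where
  2^[1+j]≡2+2Z : 2 ^ suc j ≡ 2 + 2 * Z
  2^[1+j]≡2+2Z = trans (cong (2 *_) 2^j≡) (*-suc 2 Z)

-- For odd O there are c and an odd N with N + 1 a power of two and 2^(N·2^c) ≡ 1 (mod O):
-- take 2^E ≡ 1 (mod O) and write E = 2^c·M with M odd; then E divides N·2^c for the N
-- that odd∣2^[1+j]-1 provides for M.
order-shape : ∀ u → ∃[ c ] ∃[ v ] ∃[ j ]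
                (2 ^ suc j ≡ 2 + 2 * v × 2 ^ ((1 + 2 * v) * 2 ^ c) ≡1[mod 1 + 2 * u ])
order-shape u
  with δ , 2^E≡1 ← 2^[1+δ]≡1 u
  with c , w , E≡ ← 2-adic (suc δ) z<s
  with v , j , 2^[1+j]≡ , divides r N≡ ← odd∣2^[1+j]-1 w =
  c , v , j , 2^[1+j]≡ , ^-multiple≡1 2^E≡1 (divides r (begin
    (1 + 2 * v) * 2 ^ c             ≡⟨ cong (_* 2 ^ c) N≡ ⟩
    r * (1 + 2 * w) * 2 ^ c         ≡⟨ *-assoc r (1 + 2 * w) (2 ^ c) ⟩
    r * ((1 + 2 * w) * 2 ^ c)       ≡⟨ cong (r *_) (trans (*-comm (1 + 2 * w) (2 ^ c)) (sym E≡)) ⟩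
    r * suc δ                       ∎))
  where open ≡-Reasoning

2*n≤2^n : ∀ n → 2 * n ≤ 2 ^ n
2*n≤2^n zero = z≤n
2*n≤2^n (suc zero) = ≤-refl
2*n≤2^n (suc (suc n)) = begin
  2 * suc (suc n)             ≡⟨ *-suc 2 (suc n) ⟩
  2 + 2 * suc n               ≤⟨ +-mono-≤ (*-monoʳ-≤ 2 (m^n>0 2 n)) (2*n≤2^n (suc n)) ⟩
  2 ^ suc n + 2 ^ suc n       ≡⟨ cong (2 ^ suc n +_) (+-identityʳ (2 ^ suc n)) ⟨
  2 ^ suc (suc n)             ∎
  where open ≤-Reasoning

large-index : ∀ s t m → ∃[ k ] ∃[ o ]
                (1 ≤ k × s + suc (o + k) ≡ 2 ^ k × t < 2 ^ suc k × m < 2 ^ suc k)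
large-index s t m = from-gap (m≤n⇒∃[o]m+o≡n s+k+1≤2^k)
  where
  k = suc (s + t + m)
  s+k+1≤2^k : s + suc k ≤ 2 ^ k
  s+k+1≤2^k = begin
    s + suc k      ≡⟨ +-suc s k ⟩
    suc s + k      ≤⟨ +-monoˡ-≤ k (s≤s (≤-trans (m≤m+n s t) (m≤m+n (s + t) m))) ⟩
    k + k          ≡⟨ cong (k +_) (+-identityʳ k) ⟨
    2 * k          ≤⟨ 2*n≤2^n k ⟩
    2 ^ k          ∎
    where open ≤-Reasoning
  below : ∀ {x} → x ≤ s + t + m → x < 2 ^ suc k
  below x≤ = <-≤-trans (s≤s (m≤n⇒m≤1+n x≤))
                       (≤-trans (m≤m+n (suc k) (suc k + 0)) (2*n≤2^n (suc k)))
  regroup : ∀ s o k → s + (1 + (o + k)) ≡ s + (1 + k) + o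
  regroup = solve-∀
  from-gap : ∃[ o ] s + suc k + o ≡ 2 ^ k →
             ∃[ k ] ∃[ o ] (1 ≤ k × s + suc (o + k) ≡ 2 ^ k × t < 2 ^ suc k × m < 2 ^ suc k)
  from-gap (o , gap) = k , o , s≤s z≤n , trans (regroup s o k) gap ,
    below (≤-trans (m≤n+m t s) (m≤m+n (s + t) m)) , below (m≤n+m m (s + t))

a-factor : ∀ {d s t k e} → d ≡ 2 ^ s * t → s + e ≡ 2 ^ k → a d k ≡ 2 ^ s * (2 ^ e + t)
a-factor {d} {s} {t} {k} {e} d≡ s+e≡2^k = begin
  2 ^ (2 ^ k) + d           ≡⟨ cong₂ _+_ (cong (2 ^_) (sym s+e≡2^k)) d≡ ⟩
  2 ^ (s + e) + 2 ^ s * t   ≡⟨ cong (_+ 2 ^ s * t) (^-distribˡ-+-* 2 s e) ⟩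
  2 ^ s * 2 ^ e + 2 ^ s * t ≡⟨ *-distribˡ-+ (2 ^ s) (2 ^ e) t ⟨
  2 ^ s * (2 ^ e + t)       ∎
  where open ≡-Reasoning

-- Divisors of a_k persist to a_(k+j) when 2^j = 1 + N and 2^(N·2^k) ≡ 1 (mod G):
-- then a_(k+j) = 2^(2^k)·2^(N·2^k) + d ≡ 2^(2^k) + d = a_k (mod G).
divides-later : ∀ {d G k j N} → G ∣ a d k → 2 ^ j ≡ 1 + N → 2 ^ (N * 2 ^ k) ≡1[mod G ] →
                G ∣ a d (k + j)
divides-later {d} {G} {k} {j} {N} G∣ak 2^j≡ (≡1-by q 2^[N2^k]≡) =
  subst (G ∣_) (sym a[k+j]≡) (∣m∣n⇒∣m+n G∣ak (m∣m*n (2 ^ (2 ^ k) * q)))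
  where
  open ≡-Reasoning
  a[k+j]≡ : a d (k + j) ≡ a d k + G * (2 ^ (2 ^ k) * q)
  a[k+j]≡ = begin
    2 ^ (2 ^ (k + j)) + d
      ≡⟨ cong (λ x → 2 ^ x + d) (trans (^-distribˡ-+-* 2 k j) (cong (2 ^ k *_) 2^j≡)) ⟩
    2 ^ (2 ^ k * (1 + N)) + d
      ≡⟨ cong (λ x → 2 ^ x + d) (trans (*-suc (2 ^ k) N) (cong (2 ^ k +_) (*-comm (2 ^ k) N))) ⟩
    2 ^ (2 ^ k + N * 2 ^ k) + d            ≡⟨ cong (_+ d) (^-distribˡ-+-* 2 (2 ^ k) (N * 2 ^ k)) ⟩
    2 ^ (2 ^ k) * 2 ^ (N * 2 ^ k) + d      ≡⟨ cong (λ x → 2 ^ (2 ^ k) * x + d) 2^[N2^k]≡ ⟩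
    2 ^ (2 ^ k) * (1 + G * q) + d          ≡⟨ expand (2 ^ (2 ^ k)) G q d ⟩
    2 ^ (2 ^ k) + d + G * (2 ^ (2 ^ k) * q) ∎
    where
    expand : ∀ x G q d → x * (1 + G * q) + d ≡ x + d + G * (x * q)
    expand = solve-∀

GcdBounded : ℕ → ℕ → Set
GcdBounded d m = ∀ k l → 1 ≤ k → 1 ≤ l → k ≢ l → gcd (a d k) (a d l) ≤ m

common-divisor≤ : ∀ {d m G k j} → GcdBounded d m → 1 ≤ k → 0 < j →
                  G ∣ a d k → G ∣ a d (k + j) → G ≤ m
common-divisor≤ {d} {m} {G} {k} {j} bounded 1≤k j>0 G∣ak G∣al =
  ≤-trans (∣⇒≤ (gcd-greatest G∣ak G∣al))
          (bounded k (k + j) 1≤k (≤-trans 1≤k (m≤m+n k j)) (<⇒≢ (m<m+n k j>0)))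
  where
  ak≢0 : a d k ≢ 0
  ak≢0 ak≡0 = <⇒≢ (<-≤-trans (m^n>0 2 (2 ^ k)) (m≤m+n (2 ^ (2 ^ k)) d)) (sym ak≡0)
  instance _ = ≢-nonZero (gcd[m,n]≢0 (a d k) (a d (k + j)) (inj₁ ak≢0))

<-mod-unique : ∀ {x y p q M} → x < M → y < M → x + p * M ≡ y + q * M → x ≡ y
<-mod-unique {x} {y} {p} {q} {suc M′} x<M y<M eq = begin
  x                         ≡⟨ m<n⇒m%n≡m x<M ⟨
  x % suc M′                ≡⟨ [m+kn]%n≡m%n x p (suc M′) ⟨
  (x + p * suc M′) % suc M′ ≡⟨ cong (_% suc M′) eq ⟩
  (y + q * suc M′) % suc M′ ≡⟨ [m+kn]%n≡m%n y q (suc M′) ⟩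
  y % suc M′                ≡⟨ m<n⇒m%n≡m y<M ⟩
  y                         ∎
  where open ≡-Reasoning

small-factor≡ : ∀ {G H t x M} → G < M → t < M → G * H ≡ t + x * M → H ≡1[mod M ] → G ≡ t
small-factor≡ {G} {t = t} {x} {M} G<M t<M GH≡ (≡1-by h refl) =
  <-mod-unique {p = G * h} {q = x} G<M t<M (trans (expand G M h) GH≡)
  where
  expand : ∀ G M h → G + G * h * M ≡ G * (1 + M * h)
  expand = solve-∀

2^[N*2^c]≡1-lift : ∀ {O} N c k → 2 ^ (N * 2 ^ c) ≡1[mod O ] → 2 ^ (N * 2 ^ (c + k)) ≡1[mod O ]
2^[N*2^c]≡1-lift N c k 2^≡1 =
  ^-multiple≡1 2^≡1 (*-monoʳ-∣ N (subst (2 ^ c ∣_) (cong (2 ^_) (+-comm k c)) (^-∣-^+ 2 c k)))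

-- The heart of the argument: if d = 2^s·t with t odd and the gcds are bounded by m, then t = 1.
-- Choose k by large-index, so that a_k = 2^s·O with O = 2^e + t odd and e > k. By order-shape
-- and peel, O = G·H with 2^(N·2^k) ≡ 1 (mod G), H ≡ 1 (mod 2^(k+1)) and 2^(j+1) = 1 + N.
-- Then G divides both a_k and a_(k+j+1), so G ≤ m < 2^(k+1); as O = G·H ≡ G and O ≡ t
-- modulo 2^(k+1), G = t. Hence t divides O - t = 2^e, so t = 1.
odd-part≡1 : ∀ d m s u → d ≡ 2 ^ s * (1 + 2 * u) → GcdBounded d m → 1 + 2 * u ≡ 1
odd-part≡1 d m s u d≡ bounded
  with k , o , 1≤k , s+e≡2^k , t<M , m<M ← large-index s (1 + 2 * u) m
  with c , v , j , 2^[1+j]≡ , 2^[N2^c]≡1 ← order-shape (2 ^ (o + k) + u)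
  with G , H , O≡GH , 2^[N2^k]≡1 , H≡1 ← peel v k c (1 + 2 * (2 ^ (o + k) + u)) (λ ())
                                            (2^[N*2^c]≡1-lift (1 + 2 * v) c k 2^[N2^c]≡1) =
  odd∣2^i⇒≡1 u e (∣m+n∣m⇒∣n (subst (t ∣_) (+-comm (2 ^ e) t) t∣O) ∣-refl)
  where
  t = 1 + 2 * u
  e = suc (o + k)
  odd-form : ∀ x u → 1 + 2 * (x + u) ≡ 2 * x + (1 + 2 * u)
  odd-form = solve-∀
  GH≡2^e+t : G * H ≡ 2 ^ e + t
  GH≡2^e+t = trans (sym O≡GH) (odd-form (2 ^ (o + k)) u)
  G∣O : G ∣ 2 ^ e + t
  G∣O = subst (G ∣_) GH≡2^e+t (m∣m*n H)
  G∣ak : G ∣ a d k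
  G∣ak = subst (G ∣_) (sym (a-factor {s = s} {t = t} {k = k} {e = e} d≡ s+e≡2^k))
                (∣-trans G∣O (n∣m*n (2 ^ s)))
  G∣al : G ∣ a d (k + suc j)
  G∣al = divides-later {k = k} {j = suc j} {N = 1 + 2 * v} G∣ak 2^[1+j]≡ 2^[N2^k]≡1
  GH≡t+2^e : G * H ≡ t + 2 ^ o * 2 ^ suc k
  GH≡t+2^e = trans GH≡2^e+t (trans (+-comm (2 ^ e) t)
               (cong (t +_) (trans (cong (2 ^_) (sym (+-suc o k))) (^-distribˡ-+-* 2 o (suc k)))))
  G≡t : G ≡ t
  G≡t = small-factor≡ {x = 2 ^ o} (≤-<-trans (common-divisor≤ bounded 1≤k z<s G∣ak G∣al) m<M)
                      t<M GH≡t+2^e H≡1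
  t∣O : t ∣ 2 ^ e + t
  t∣O = subst (_∣ 2 ^ e + t) G≡t G∣O

lemma3 : (d m : ℕ) → 1 < d → 1 ≤ m →
         (∀ k l → 1 ≤ k → 1 ≤ l → k ≢ l → gcd (a d k) (a d l) ≤ m) →
         ∃[ j ] d ≡ 2 ^ j
lemma3 d m 1<d _ bounded with s , u , d≡ ← 2-adic d (<-trans z<s 1<d) =
  s , trans d≡ (trans (cong (2 ^ s *_) (odd-part≡1 d m s u d≡ bounded)) (*-identityʳ (2 ^ s)))
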